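{- The set of intrinsic $\mathcal{L}_T$ sentences and the set of inevitable $\mathcal{L}_T$ sentences are $\mathbf{FIX}$-indiscernible.
   Context: Kripke fixed points. $\mathcal{L}_T$ is first-order arithmetic plus a unary predicate $\mathsf{True}$, with standard Gödel numbering $\ulcorner\cdot\urcorner$. Sentences are evaluated in strong Kleene logic $\mathsf{K3}$ (values \textsc{true}, \textsc{false}, \textsc{neither}; $\wedge$ true iff both true, false iff one false; $\neg$ swaps true/false; $\forall$ true iff all instances true, false iff some instance false; otherwise neither). For $S\subseteq\mathbb{N}$, $\mathbb{N}_S$ interprets arithmetic standardly and makes $\mathsf{True}(n)$ true iff $n\in S$, false iff $n$ is not a sentence code or $n=\ulcorner\varphi\urcorner$ with $\ulcorner\neg\varphi\urcorner\in S$, neither otherwise. A fixed point is a set $S$ of sentence codes with $S=\{\ulcorner\varphi\urcorner:\varphi\text{ true in }\mathbb{N}_S\}$ and no $\varphi$ with both $\ulcorner\varphi\urcorner,\ulcorner\neg\varphi\urcorner\in S$; values in $S$ are values in $\mathbb{N}_S$. $\mathbf{FIX}$ is the set of fixed points. A sentence is inevitable if it has one of the values \textsc{true}, \textsc{false} in some fixed point and the other of these two values in no fixed point. A fixed point $w$ is intrinsic if for every fixed point $v$, the set of sentences \textsc{true} in $w$ together with those \textsc{true} in $v$ is consistent (contains no $\varphi$ together with $\neg\varphi$); a sentence is intrinsic if it is \textsc{true} or \textsc{false} in some intrinsic fixed point. Modal language and semantics. $\mathcal{L}_\Box$: formulas $\varphi::=T(x)\mid F(x)\mid\neg\varphi\mid(\varphi\wedge\varphi)\mid\Box\varphi$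 over countably many variables; $\lozenge$ etc. abbreviations. A realization $\star$ assigns each variable $x$ an $\mathcal{L}_T$ sentence $x^\star$. For $w\in\mathbf{FIX}$: $w\Vdash_\star T(x)$ iff $x^\star$ is \textsc{true} in $w$; $w\Vdash_\star F(x)$ iff $x^\star$ is \textsc{false} in $w$; Boolean connectives classical; $w\Vdash_\star\Box\varphi$ iff $v\Vdash_\star\varphi$ for all $v\in\mathbf{FIX}$. $\mathbf{FIX}\Vdash_\star\varphi$ means $w\Vdash_\star\varphi$ for all $w\in\mathbf{FIX}$. Indiscernibility. Sets $\mathcal{A},\mathcal{B}$ of $\mathcal{L}_T$ sentences are $\mathbf{FIX}$-indiscernible if for every formula $\varphi(x)$ of $\mathcal{L}_\Box$ (with single variable $x$) the following are equivalent: (1) for all realizations $\star$ with $x^\star\in\mathcal{A}$, $\mathbf{FIX}\Vdash_\star\varphi(x)$; (2) for all realizations $\star$ with $x^\star\in\mathcal{B}$, $\mathbf{FIX}\Vdash_\star\varphi(x)$. -}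

module Defs where

open import Level using (Level; Lift; lift) renaming (zero to lzero; suc to lsuc)
open import Data.Nat using (ℕ; zero; suc; _+_; _*_; _^_)
open import Data.Fin using (Fin; toℕ)
open import Data.Vec using (Vec; []; _∷_; lookup)
open import Data.Product using (Σ; ∃; _×_; _,_)
open import Data.Sum using (_⊎_)
open import Relation.Nullary using (¬_)
open import Relation.Binary.PropositionalEquality using (_≡_; _≢_)

-- Terms and formulas are indexed by the number of free
-- variables (de Bruijn); sentences are formulas with no free variables.

data Tm (n : ℕ) : Set where
  var   : Fin n → Tm n
  zer   : Tm n
  succ  : Tm n → Tm n
  plus  : Tm n → Tm n → Tm n
  times : Tm n → Tm n → Tm n

data Fm (n : ℕ) : Set where
  eq   : Tm n → Tm n → Fm n
  tru  : Tm n → Fm n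
  neg  : Fm n → Fm n
  and  : Fm n → Fm n → Fm n
  all  : Fm (suc n) → Fm n

Sentence : Set
Sentence = Fm 0

⟪_,_⟫ : ℕ → ℕ → ℕ
⟪ a , b ⟫ = (2 ^ a) * (2 * b + 1)

codeTm : ∀ {n} → Tm n → ℕ
codeTm (var i)     = ⟪ 0 , toℕ i ⟫
codeTm zer         = ⟪ 1 , 0 ⟫
codeTm (succ t)    = ⟪ 2 , codeTm t ⟫
codeTm (plus t s)  = ⟪ 3 , ⟪ codeTm t , codeTm s ⟫ ⟫
codeTm (times t s) = ⟪ 4 , ⟪ codeTm t , codeTm s ⟫ ⟫

codeFm : ∀ {n} → Fm n → ℕ
codeFm (eq t s)  = ⟪ 0 , ⟪ codeTm t , codeTm s ⟫ ⟫
codeFm (tru t)   = ⟪ 1 , codeTm t ⟫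
codeFm (neg φ)   = ⟪ 2 , codeFm φ ⟫
codeFm (and φ ψ) = ⟪ 3 , ⟪ codeFm φ , codeFm ψ ⟫ ⟫
codeFm (all φ)   = ⟪ 4 , codeFm φ ⟫

⌜_⌝ : Sentence → ℕ
⌜ φ ⌝ = codeFm φ

IsSentenceCode : ℕ → Set
IsSentenceCode n = Σ Sentence λ φ → ⌜ φ ⌝ ≡ n

evalTm : ∀ {n} → Vec ℕ n → Tm n → ℕ
evalTm ρ (var i)     = lookup ρ i
evalTm ρ zer         = 0
evalTm ρ (succ t)    = suc (evalTm ρ t)
evalTm ρ (plus t s)  = evalTm ρ t + evalTm ρ s
evalTm ρ (times t s) = evalTm ρ t * evalTm ρ s

-- Strong Kleene evaluation in ℕ_S.  Tr = value true, Fa = value false,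
-- neither = neither of them.

module K3 (S : ℕ → Set) where

  data Tr : ∀ {n} → Vec ℕ n → Fm n → Set
  data Fa : ∀ {n} → Vec ℕ n → Fm n → Set

  data Tr where
    eqT  : ∀ {n} {ρ : Vec ℕ n} {t s} → evalTm ρ t ≡ evalTm ρ s → Tr ρ (eq t s)
    truT : ∀ {n} {ρ : Vec ℕ n} {t} → S (evalTm ρ t) → Tr ρ (tru t)
    negT : ∀ {n} {ρ : Vec ℕ n} {φ} → Fa ρ φ → Tr ρ (neg φ)
    andT : ∀ {n} {ρ : Vec ℕ n} {φ ψ} → Tr ρ φ → Tr ρ ψ → Tr ρ (and φ ψ)
    allT : ∀ {n} {ρ : Vec ℕ n} {φ} → (∀ m → Tr (m ∷ ρ) φ) → Tr ρ (all φ)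

  data Fa where
    eqF     : ∀ {n} {ρ : Vec ℕ n} {t s} → evalTm ρ t ≢ evalTm ρ s → Fa ρ (eq t s)
    truFnc  : ∀ {n} {ρ : Vec ℕ n} {t} → ¬ IsSentenceCode (evalTm ρ t) → Fa ρ (tru t)
    truFneg : ∀ {n} {ρ : Vec ℕ n} {t} (φ : Sentence) →
              ⌜ φ ⌝ ≡ evalTm ρ t → S ⌜ neg φ ⌝ → Fa ρ (tru t)
    negF    : ∀ {n} {ρ : Vec ℕ n} {φ} → Tr ρ φ → Fa ρ (neg φ)
    andF₁   : ∀ {n} {ρ : Vec ℕ n} {φ ψ} → Fa ρ φ → Fa ρ (and φ ψ)
    andF₂   : ∀ {n} {ρ : Vec ℕ n} {φ ψ} → Fa ρ ψ → Fa ρ (and φ ψ)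
    allF    : ∀ {n} {ρ : Vec ℕ n} {φ} (m : ℕ) → Fa (m ∷ ρ) φ → Fa ρ (all φ)

TrueIn : (ℕ → Set) → Sentence → Set
TrueIn S φ = K3.Tr S [] φ

FalseIn : (ℕ → Set) → Sentence → Set
FalseIn S φ = K3.Fa S [] φ

record FixedPoint : Set₁ where
  field
    S          : ℕ → Set
    sentCodes  : ∀ n → S n → IsSentenceCode n
    closed→    : ∀ φ → S ⌜ φ ⌝ → TrueIn S φ
    closed←    : ∀ φ → TrueIn S φ → S ⌜ φ ⌝
    consistent : ∀ φ → ¬ (S ⌜ φ ⌝ × S ⌜ neg φ ⌝)

open FixedPoint public

TrueAt : FixedPoint → Sentence → Set
TrueAt w φ = TrueIn (S w) φ

FalseAt : FixedPoint → Sentence → Set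
FalseAt w φ = FalseIn (S w) φ

Inevitable : Sentence → Set₁
Inevitable φ =
    ((Σ FixedPoint λ w → TrueAt w φ) × ¬ (Σ FixedPoint λ v → FalseAt v φ))
  ⊎ ((Σ FixedPoint λ w → FalseAt w φ) × ¬ (Σ FixedPoint λ v → TrueAt v φ))

IntrinsicFP : FixedPoint → Set₁
IntrinsicFP w = ∀ (v : FixedPoint) →
  ¬ (Σ Sentence λ φ → (TrueAt w φ ⊎ TrueAt v φ) × (TrueAt w (neg φ) ⊎ TrueAt v (neg φ)))

Intrinsic : Sentence → Set₁
Intrinsic φ = Σ FixedPoint λ w → IntrinsicFP w × (TrueAt w φ ⊎ FalseAt w φ)

data MFm : Set where
  T    : ℕ → MFm
  F    : ℕ → MFm
  ¬ₘ_  : MFm → MFm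
  _∧ₘ_ : MFm → MFm → MFm
  □_   : MFm → MFm

OnlyVar : ℕ → MFm → Set
OnlyVar x (T y)    = y ≡ x
OnlyVar x (F y)    = y ≡ x
OnlyVar x (¬ₘ φ)   = OnlyVar x φ
OnlyVar x (φ ∧ₘ ψ) = OnlyVar x φ × OnlyVar x ψ
OnlyVar x (□ φ)    = OnlyVar x φ

Realization : Set
Realization = ℕ → Sentence

_⊩[_]_ : FixedPoint → Realization → MFm → Set₁
w ⊩[ ⋆ ] T x    = Lift (lsuc lzero) (TrueAt w (⋆ x))
w ⊩[ ⋆ ] F x    = Lift (lsuc lzero) (FalseAt w (⋆ x))
w ⊩[ ⋆ ] (¬ₘ φ)   = ¬ (w ⊩[ ⋆ ] φ)
w ⊩[ ⋆ ] (φ ∧ₘ ψ) = (w ⊩[ ⋆ ] φ) × (w ⊩[ ⋆ ] ψ)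
w ⊩[ ⋆ ] (□ φ)    = ∀ (v : FixedPoint) → v ⊩[ ⋆ ] φ

FIX⊩[_]_ : Realization → MFm → Set₁
FIX⊩[ ⋆ ] φ = ∀ (w : FixedPoint) → w ⊩[ ⋆ ] φ

Indiscernible : (Sentence → Set₁) → (Sentence → Set₁) → Set₁
Indiscernible A B = ∀ (x : ℕ) (φ : MFm) → OnlyVar x φ →
    ((∀ (⋆ : Realization) → A (⋆ x) → FIX⊩[ ⋆ ] φ) → (∀ (⋆ : Realization) → B (⋆ x) → FIX⊩[ ⋆ ] φ))
  × ((∀ (⋆ : Realization) → B (⋆ x) → FIX⊩[ ⋆ ] φ) → (∀ (⋆ : Realization) → A (⋆ x) → FIX⊩[ ⋆ ] φ))

-- Every intrinsic sentence is inevitable, which gives one direction. For the other, the forcing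
-- of a one-variable formula depends only on the value the realized sentence takes at each fixed
-- point and on which values it takes across FIX. An inevitable σ that already has a value in the
-- least fixed point is intrinsic itself. Otherwise σ takes its values exactly like ρ (if σ is
-- never false) or like ¬ρ (if σ is never true), where ρ says that ρ is not a glut (true and
-- false at once): ρ is never false, not true in the least fixed point, and true in the least
-- fixed point containing it, which is intrinsic. This transfer of forcing is classical and runs
-- in the double-negation monad; atoms outside the scope of a negation need no transfer, since
-- none is valid for all intrinsic realizations.
--
-- ρ needs no coding apparatus. It is ∀x ∀p ¬((Θ(x, p) ∧ glut(x)) ∧ p = dbl ⌜ Aρ ⌝), where the
-- term dbl k = 2 · (2 · ⋯ 1) has value 2 ^ k and a code obeying an affine recurrence; so the code
-- of dbl k, and with it ⌜ ρ ⌝, is an arithmetical function of p = 2 ^ k that Θ can pin down.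
module Submission where

open import Level using (lift; lower) renaming (suc to lsuc; zero to lzero)
open import Defs
open import Data.Nat using (ℕ; zero; suc; _+_; _*_; _^_; _≤_; z≤n; s≤s; _≟_; >-nonZero)
open import Data.Nat.Properties
  using (suc-injective; even≢odd; +-identityʳ; +-comm; +-assoc; *-assoc; *-comm;
         +-cancelˡ-≡; +-cancelʳ-≡; *-cancelˡ-≡; ^-*-assoc)
open import Data.Nat.Tactic.RingSolver using (solve-∀)
open import Data.Fin using (zero; suc; toℕ)
open import Data.Fin.Properties using (toℕ-injective)
open import Data.List using (List; []; _∷_)
open import Data.Vec using (Vec; []; _∷_)
open import Data.Product using (Σ; Σ-syntax; _×_; _,_; proj₁; proj₂; map₁; map₂)
open import Data.Sum using (_⊎_; inj₁; inj₂; [_,_])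
open import Data.Empty using (⊥; ⊥-elim)
open import Effect.Monad using (RawMonad)
open import Function using (id; _∘_; const; _⇔_; mk⇔; Equivalence)
open import Function.Construct.Identity using (⇔-id)
open import Function.Construct.Symmetry using (⇔-sym)
open import Relation.Nullary using (¬_; Dec; yes; no)
open import Relation.Nullary.Decidable using (¬¬-excluded-middle)
open import Relation.Nullary.Negation using (¬¬-Monad; ¬¬-map; negated-stable)
open import Relation.Unary using (_⊆_; ∅; ｛_｝; _∪_)
open import Relation.Binary.PropositionalEquality
  using (_≡_; _≢_; refl; sym; trans; cong; cong₂; subst; module ≡-Reasoning)
open K3
open RawMonad (¬¬-Monad {a = lsuc lzero}) using (_>>=_; pure)

private
  variable
    m n : ℕ
    X X₁ X₂ : ℕ → Set
    e : Vec ℕ n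
    φ : Fm n
    σ σ′ : Sentence
    v v′ w : FixedPoint

pair-zero : ∀ b → ⟪ 0 , b ⟫ ≡ suc (2 * b)
pair-zero b = trans (+-identityʳ (2 * b + 1)) (+-comm (2 * b) 1)

pair-suc : ∀ a b → ⟪ suc a , b ⟫ ≡ 2 * ⟪ a , b ⟫
pair-suc a b = *-assoc 2 (2 ^ a) (2 * b + 1)

pair-injective : ∀ {a b c d} → ⟪ a , b ⟫ ≡ ⟪ c , d ⟫ → a ≡ c × b ≡ d
pair-injective {zero} {b} {zero} {d} h =
  refl , *-cancelˡ-≡ b d 2 (suc-injective (trans (sym (pair-zero b)) (trans h (pair-zero d))))
pair-injective {zero} {b} {suc c} {d} h =
  ⊥-elim (even≢odd ⟪ c , d ⟫ b (trans (sym (pair-suc c d)) (trans (sym h) (pair-zero b))))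
pair-injective {suc a} {b} {zero} {d} h =
  ⊥-elim (even≢odd ⟪ a , b ⟫ d (trans (sym (pair-suc a b)) (trans h (pair-zero d))))
pair-injective {suc a} {b} {suc c} {d} h =
  map₁ (cong suc) (pair-injective {a} {b} {c} {d}
    (*-cancelˡ-≡ ⟪ a , b ⟫ ⟪ c , d ⟫ 2 (trans (sym (pair-suc a b)) (trans h (pair-suc c d)))))

tagTm argTm : Tm n → ℕ
tagTm (var _)     = 0
tagTm zer         = 1
tagTm (succ _)    = 2
tagTm (plus _ _)  = 3
tagTm (times _ _) = 4
argTm (var i)     = toℕ i
argTm zer         = 0
argTm (succ t)    = codeTm t
argTm (plus t s)  = ⟪ codeTm t , codeTm s ⟫
argTm (times t s) = ⟪ codeTm t , codeTm s ⟫

codeTm-tag-arg : (t : Tm n) → codeTm t ≡ ⟪ tagTm t , argTm t ⟫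
codeTm-tag-arg (var _)     = refl
codeTm-tag-arg zer         = refl
codeTm-tag-arg (succ _)    = refl
codeTm-tag-arg (plus _ _)  = refl
codeTm-tag-arg (times _ _) = refl

tagFm argFm : Fm n → ℕ
tagFm (eq _ _)  = 0
tagFm (tru _)   = 1
tagFm (neg _)   = 2
tagFm (and _ _) = 3
tagFm (all _)   = 4
argFm (eq t s)  = ⟪ codeTm t , codeTm s ⟫
argFm (tru t)   = codeTm t
argFm (neg φ)   = codeFm φ
argFm (and φ ψ) = ⟪ codeFm φ , codeFm ψ ⟫
argFm (all φ)   = codeFm φ

codeFm-tag-arg : (φ : Fm n) → codeFm φ ≡ ⟪ tagFm φ , argFm φ ⟫
codeFm-tag-arg (eq _ _)  = refl
codeFm-tag-arg (tru _)   = refl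
codeFm-tag-arg (neg _)   = refl
codeFm-tag-arg (and _ _) = refl
codeFm-tag-arg (all _)   = refl

codeTm-injective : (t s : Tm n) → codeTm t ≡ codeTm s → t ≡ s
codeTm-injective t s h =
  tag-arg-injective t s (pair-injective (trans (sym (codeTm-tag-arg t)) (trans h (codeTm-tag-arg s))))
  where
  tag-arg-injective : (t s : Tm n) → tagTm t ≡ tagTm s × argTm t ≡ argTm s → t ≡ s
  tag-arg-injective (var i) (var j) (_ , h) = cong var (toℕ-injective h)
  tag-arg-injective zer zer _ = refl
  tag-arg-injective (succ t) (succ s) (_ , h) = cong succ (codeTm-injective t s h)
  tag-arg-injective (plus t t′) (plus s s′) (_ , h) with pair-injective h
  ... | h₁ , h₂ = cong₂ plus (codeTm-injective t s h₁) (codeTm-injective t′ s′ h₂)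
  tag-arg-injective (times t t′) (times s s′) (_ , h) with pair-injective h
  ... | h₁ , h₂ = cong₂ times (codeTm-injective t s h₁) (codeTm-injective t′ s′ h₂)
  tag-arg-injective (var _) zer (() , _)
  tag-arg-injective (var _) (succ _) (() , _)
  tag-arg-injective (var _) (plus _ _) (() , _)
  tag-arg-injective (var _) (times _ _) (() , _)
  tag-arg-injective zer (var _) (() , _)
  tag-arg-injective zer (succ _) (() , _)
  tag-arg-injective zer (plus _ _) (() , _)
  tag-arg-injective zer (times _ _) (() , _)
  tag-arg-injective (succ _) (var _) (() , _)
  tag-arg-injective (succ _) zer (() , _)
  tag-arg-injective (succ _) (plus _ _) (() , _)
  tag-arg-injective (succ _) (times _ _) (() , _)
  tag-arg-injective (plus _ _) (var _) (() , _)
  tag-arg-injective (plus _ _) zer (() , _)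
  tag-arg-injective (plus _ _) (succ _) (() , _)
  tag-arg-injective (plus _ _) (times _ _) (() , _)
  tag-arg-injective (times _ _) (var _) (() , _)
  tag-arg-injective (times _ _) zer (() , _)
  tag-arg-injective (times _ _) (succ _) (() , _)
  tag-arg-injective (times _ _) (plus _ _) (() , _)

codeFm-injective : (φ ψ : Fm n) → codeFm φ ≡ codeFm ψ → φ ≡ ψ
codeFm-injective φ ψ h =
  tag-arg-injective φ ψ (pair-injective (trans (sym (codeFm-tag-arg φ)) (trans h (codeFm-tag-arg ψ))))
  where
  tag-arg-injective : (φ ψ : Fm n) → tagFm φ ≡ tagFm ψ × argFm φ ≡ argFm ψ → φ ≡ ψ
  tag-arg-injective (eq t t′) (eq s s′) (_ , h) with pair-injective h
  ... | h₁ , h₂ = cong₂ eq (codeTm-injective t s h₁) (codeTm-injective t′ s′ h₂)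
  tag-arg-injective (tru t) (tru s) (_ , h) = cong tru (codeTm-injective t s h)
  tag-arg-injective (neg φ) (neg ψ) (_ , h) = cong neg (codeFm-injective φ ψ h)
  tag-arg-injective (and φ φ′) (and ψ ψ′) (_ , h) with pair-injective h
  ... | h₁ , h₂ = cong₂ and (codeFm-injective φ ψ h₁) (codeFm-injective φ′ ψ′ h₂)
  tag-arg-injective (all φ) (all ψ) (_ , h) = cong all (codeFm-injective φ ψ h)
  tag-arg-injective (eq _ _) (tru _) (() , _)
  tag-arg-injective (eq _ _) (neg _) (() , _)
  tag-arg-injective (eq _ _) (and _ _) (() , _)
  tag-arg-injective (eq _ _) (all _) (() , _)
  tag-arg-injective (tru _) (eq _ _) (() , _)
  tag-arg-injective (tru _) (neg _) (() , _)
  tag-arg-injective (tru _) (and _ _) (() , _)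
  tag-arg-injective (tru _) (all _) (() , _)
  tag-arg-injective (neg _) (eq _ _) (() , _)
  tag-arg-injective (neg _) (tru _) (() , _)
  tag-arg-injective (neg _) (and _ _) (() , _)
  tag-arg-injective (neg _) (all _) (() , _)
  tag-arg-injective (and _ _) (eq _ _) (() , _)
  tag-arg-injective (and _ _) (tru _) (() , _)
  tag-arg-injective (and _ _) (neg _) (() , _)
  tag-arg-injective (and _ _) (all _) (() , _)
  tag-arg-injective (all _) (eq _ _) (() , _)
  tag-arg-injective (all _) (tru _) (() , _)
  tag-arg-injective (all _) (neg _) (() , _)
  tag-arg-injective (all _) (and _ _) (() , _)

Tr-mono : X₁ ⊆ X₂ → Tr X₁ e φ → Tr X₂ e φ
Fa-mono : X₁ ⊆ X₂ → Fa X₁ e φ → Fa X₂ e φ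
Tr-mono inc (eqT h)    = eqT h
Tr-mono inc (truT x)   = truT (inc x)
Tr-mono inc (negT f)   = negT (Fa-mono inc f)
Tr-mono inc (andT t u) = andT (Tr-mono inc t) (Tr-mono inc u)
Tr-mono inc (allT t)   = allT (λ m → Tr-mono inc (t m))
Fa-mono inc (eqF h)         = eqF h
Fa-mono inc (truFnc h)      = truFnc h
Fa-mono inc (truFneg χ h x) = truFneg χ h (inc x)
Fa-mono inc (negF t)        = negF (Tr-mono inc t)
Fa-mono inc (andF₁ f)       = andF₁ (Fa-mono inc f)
Fa-mono inc (andF₂ f)       = andF₂ (Fa-mono inc f)
Fa-mono inc (allF m f)      = allF m (Fa-mono inc f)

Tr-neg⁻ : Tr X e (neg φ) → Fa X e φ
Tr-neg⁻ (negT f) = f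

Fa-neg⁻ : Fa X e (neg φ) → Tr X e φ
Fa-neg⁻ (negF t) = t

Consistent : (ℕ → Set) → Set
Consistent X = ∀ χ → ¬ (X ⌜ χ ⌝ × X ⌜ neg χ ⌝)

Tr-Fa-exclusive : X ⊆ IsSentenceCode → Consistent X → Tr X e φ → Fa X e φ → ⊥
Tr-Fa-exclusive         codes cons (eqT h)    (eqF h′)         = h′ h
Tr-Fa-exclusive         codes cons (truT x)   (truFnc h)       = h (codes x)
Tr-Fa-exclusive {X = X} codes cons (truT x)   (truFneg χ h x′) = cons χ (subst X (sym h) x , x′)
Tr-Fa-exclusive         codes cons (negT f)   (negF t)         = Tr-Fa-exclusive codes cons t f
Tr-Fa-exclusive         codes cons (andT t _) (andF₁ f)        = Tr-Fa-exclusive codes cons t f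
Tr-Fa-exclusive         codes cons (andT _ t) (andF₂ f)        = Tr-Fa-exclusive codes cons t f
Tr-Fa-exclusive         codes cons (allT t)   (allF m f)       = Tr-Fa-exclusive codes cons (t m) f

data LFP (B : ℕ → Set) : ℕ → Set where
  base : ∀ {n} → B n → LFP B n
  jump : ∀ φ → TrueIn (LFP B) φ → LFP B ⌜ φ ⌝

module _ {B X : ℕ → Set} (B⊆X : B ⊆ X) (X-closed : ∀ φ → TrueIn X φ → X ⌜ φ ⌝) where

  LFP-least : LFP B ⊆ X
  private
    Tr-least : Tr (LFP B) e φ → Tr X e φ
    Fa-least : Fa (LFP B) e φ → Fa X e φ

  LFP-least (base b)   = B⊆X b
  LFP-least (jump φ t) = X-closed φ (Tr-least t)

  Tr-least (eqT h)    = eqT h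
  Tr-least (truT l)   = truT (LFP-least l)
  Tr-least (negT f)   = negT (Fa-least f)
  Tr-least (andT t u) = andT (Tr-least t) (Tr-least u)
  Tr-least (allT t)   = allT (λ m → Tr-least (t m))
  Fa-least (eqF h)         = eqF h
  Fa-least (truFnc h)      = truFnc h
  Fa-least (truFneg χ h l) = truFneg χ h (LFP-least l)
  Fa-least (negF t)        = negF (Tr-least t)
  Fa-least (andF₁ f)       = andF₁ (Fa-least f)
  Fa-least (andF₂ f)       = andF₂ (Fa-least f)
  Fa-least (allF m f)      = allF m (Fa-least f)

module _ {B : ℕ → Set} (B-codes : B ⊆ IsSentenceCode) (B-sound : ∀ φ → B ⌜ φ ⌝ → TrueIn B φ)
         (B-consistent : Consistent B) where

  private
    L : ℕ → Set
    L = LFP B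

  LFP-codes : L ⊆ IsSentenceCode
  LFP-codes (base b)   = B-codes b
  LFP-codes (jump φ _) = φ , refl

  LFP-sound : L m → ∀ φ → ⌜ φ ⌝ ≡ m → TrueIn L φ
  LFP-sound (base b) φ refl = Tr-mono base (B-sound φ b)
  LFP-sound (jump ψ t) φ h with codeFm-injective φ ψ h
  ... | refl = t

  -- A clash between a base code and a jumped code is traced into the derivation of the jumped
  -- sentence, never into the one B-sound supplies: this keeps the mutual recursion structural.
  Tr-Fa-exclusiveᴸᴸ : Tr L e φ → Fa L e φ → ⊥
  Tr-Fa-exclusiveᴮᴸ : Tr B e φ → Fa L e φ → ⊥
  Tr-Fa-exclusiveᴸᴮ : Tr L e φ → Fa B e φ → ⊥
  clashᴸᴸ : ∀ χ → L m → L n → ⌜ χ ⌝ ≡ m → ⌜ neg χ ⌝ ≡ n → ⊥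
  clashᴮᴸ : ∀ χ → B m → L n → ⌜ χ ⌝ ≡ m → ⌜ neg χ ⌝ ≡ n → ⊥
  clashᴸᴮ : ∀ χ → L m → B n → ⌜ χ ⌝ ≡ m → ⌜ neg χ ⌝ ≡ n → ⊥

  Tr-Fa-exclusiveᴸᴸ (eqT h)    (eqF h′)         = h′ h
  Tr-Fa-exclusiveᴸᴸ (truT l)   (truFnc h)       = h (LFP-codes l)
  Tr-Fa-exclusiveᴸᴸ (truT l)   (truFneg χ h l′) = clashᴸᴸ χ l l′ h refl
  Tr-Fa-exclusiveᴸᴸ (negT f)   (negF t)         = Tr-Fa-exclusiveᴸᴸ t f
  Tr-Fa-exclusiveᴸᴸ (andT t _) (andF₁ f)        = Tr-Fa-exclusiveᴸᴸ t f
  Tr-Fa-exclusiveᴸᴸ (andT _ t) (andF₂ f)        = Tr-Fa-exclusiveᴸᴸ t f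
  Tr-Fa-exclusiveᴸᴸ (allT t)   (allF m f)       = Tr-Fa-exclusiveᴸᴸ (t m) f

  Tr-Fa-exclusiveᴮᴸ (eqT h)    (eqF h′)         = h′ h
  Tr-Fa-exclusiveᴮᴸ (truT b)   (truFnc h)       = h (B-codes b)
  Tr-Fa-exclusiveᴮᴸ (truT b)   (truFneg χ h l)  = clashᴮᴸ χ b l h refl
  Tr-Fa-exclusiveᴮᴸ (negT f)   (negF t)         = Tr-Fa-exclusiveᴸᴮ t f
  Tr-Fa-exclusiveᴮᴸ (andT t _) (andF₁ f)        = Tr-Fa-exclusiveᴮᴸ t f
  Tr-Fa-exclusiveᴮᴸ (andT _ t) (andF₂ f)        = Tr-Fa-exclusiveᴮᴸ t f
  Tr-Fa-exclusiveᴮᴸ (allT t)   (allF m f)       = Tr-Fa-exclusiveᴮᴸ (t m) f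

  Tr-Fa-exclusiveᴸᴮ (eqT h)    (eqF h′)         = h′ h
  Tr-Fa-exclusiveᴸᴮ (truT l)   (truFnc h)       = h (LFP-codes l)
  Tr-Fa-exclusiveᴸᴮ (truT l)   (truFneg χ h b)  = clashᴸᴮ χ l b h refl
  Tr-Fa-exclusiveᴸᴮ (negT f)   (negF t)         = Tr-Fa-exclusiveᴮᴸ t f
  Tr-Fa-exclusiveᴸᴮ (andT t _) (andF₁ f)        = Tr-Fa-exclusiveᴸᴮ t f
  Tr-Fa-exclusiveᴸᴮ (andT _ t) (andF₂ f)        = Tr-Fa-exclusiveᴸᴮ t f
  Tr-Fa-exclusiveᴸᴮ (allT t)   (allF m f)       = Tr-Fa-exclusiveᴸᴮ (t m) f

  clashᴸᴸ χ (base b)   l′          h h′ = clashᴮᴸ χ b l′ h h′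
  clashᴸᴸ χ (jump φ t) (base b)    h h′ = clashᴸᴮ χ (jump φ t) b h h′
  clashᴸᴸ χ (jump φ t) (jump ψ t′) h h′ with codeFm-injective χ φ h | codeFm-injective (neg χ) ψ h′
  clashᴸᴸ χ (jump φ t) (jump _ (negT f)) h h′ | refl | refl = Tr-Fa-exclusiveᴸᴸ t f

  clashᴮᴸ χ b (base b′)  refl refl = B-consistent χ (b , b′)
  clashᴮᴸ χ b (jump ψ t) refl h with codeFm-injective (neg χ) ψ h
  clashᴮᴸ χ b (jump _ (negT f)) refl h | refl = Tr-Fa-exclusiveᴮᴸ (B-sound χ b) f

  clashᴸᴮ χ (base b)   b′ refl refl = B-consistent χ (b , b′)
  clashᴸᴮ χ (jump φ t) b′ h    refl with codeFm-injective χ φ h | B-sound (neg χ) b′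
  ... | refl | negT f = Tr-Fa-exclusiveᴸᴮ t f

  lfp : FixedPoint
  lfp = record
    { S          = L
    ; sentCodes  = λ _ → LFP-codes
    ; closed→    = λ φ l → LFP-sound l φ refl
    ; closed←    = jump
    ; consistent = λ χ (l , l′) → clashᴸᴸ χ l l′ refl refl
    }

fixedPoint-exclusive : ∀ v → Tr (S v) e φ → Fa (S v) e φ → ⊥
fixedPoint-exclusive v = Tr-Fa-exclusive (sentCodes v _) (consistent v)

TrueAt-mono : S v ⊆ S v′ → TrueAt v σ → TrueAt v′ σ
TrueAt-mono {v} {v′} {σ} inc t = closed→ v′ σ (inc (closed← v σ t))

FalseAt-mono : S v ⊆ S v′ → FalseAt v σ → FalseAt v′ σ
FalseAt-mono {v} {v′} inc f = Tr-neg⁻ (TrueAt-mono {v} {v′} inc (negT f))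

leastFP : FixedPoint
leastFP = lfp {B = ∅} (λ ()) (λ _ ()) (λ _ ())

leastFP-⊆ : ∀ v → S leastFP ⊆ S v
leastFP-⊆ v = LFP-least (λ ()) (closed← v)

compatible⇒intrinsic : (∀ v → Σ[ u ∈ FixedPoint ] S w ⊆ S u × S v ⊆ S u) → IntrinsicFP w
compatible⇒intrinsic {w} compatible v (χ , χ-true , ¬χ-true) with compatible v
... | u , w⊆u , v⊆u = fixedPoint-exclusive u (into χ-true) (Tr-neg⁻ (into ¬χ-true))
  where
  into : TrueAt w σ ⊎ TrueAt v σ → TrueAt u σ
  into = [ TrueAt-mono {w} {u} w⊆u , TrueAt-mono {v} {u} v⊆u ]

leastFP-intrinsic : IntrinsicFP leastFP
leastFP-intrinsic = compatible⇒intrinsic {leastFP} λ v → v , leastFP-⊆ v , id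

-- Removing ⌜ σ ⌝ from leastFP leaves a set closed under truth, so by minimality ⌜ σ ⌝ ∉ leastFP.
needs-own-value⇒not-true-in-leastFP : (∀ {X} → TrueIn X σ → X ⌜ σ ⌝ ⊎ X ⌜ neg σ ⌝) →
                                       ¬ FalseAt leastFP σ → ¬ TrueAt leastFP σ
needs-own-value⇒not-true-in-leastFP {σ} needs-value not-false t =
  proj₂ (LFP-least (λ ()) closed (closed← leastFP σ t)) refl
  where
  leastFP-without-σ : ℕ → Set
  leastFP-without-σ n = S leastFP n × n ≢ ⌜ σ ⌝

  not-true : ¬ TrueIn leastFP-without-σ σ
  not-true t with needs-value t
  ... | inj₁ (_ , ≢σ) = ≢σ refl
  ... | inj₂ (s , _)  = not-false (Tr-neg⁻ (closed→ leastFP (neg σ) s))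

  closed : ∀ φ → TrueIn leastFP-without-σ φ → leastFP-without-σ ⌜ φ ⌝
  closed φ t = closed← leastFP φ (Tr-mono proj₁ t) ,
               λ h → not-true (subst (TrueIn leastFP-without-σ) (codeFm-injective φ σ h) t)

affine-differences : ∀ (f : ℕ → ℕ) a b → (∀ k → f (suc k) ≡ a * f k + b) →
                     ∀ k → f (suc k) + a ^ k * f 0 ≡ f k + a ^ k * f 1
affine-differences f a b step zero = swap (f 1) (f 0)
  where
  swap : ∀ x y → x + 1 * y ≡ y + 1 * x
  swap = solve-∀
affine-differences f a b step (suc k) = begin
  f (2 + k) + a * a ^ k * f 0          ≡⟨ cong (_+ a * a ^ k * f 0) (step (suc k)) ⟩
  a * f (suc k) + b + a * a ^ k * f 0  ≡⟨ factor a (f (suc k)) b (a ^ k) (f 0) ⟩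
  a * (f (suc k) + a ^ k * f 0) + b    ≡⟨ cong (λ y → a * y + b) (affine-differences f a b step k) ⟩
  a * (f k + a ^ k * f 1) + b          ≡⟨ factor a (f k) b (a ^ k) (f 1) ⟨
  a * f k + b + a * a ^ k * f 1        ≡⟨ cong (_+ a * a ^ k * f 1) (step k) ⟨
  f (suc k) + a * a ^ k * f 1          ∎
  where
  open ≡-Reasoning
  factor : ∀ a x b q y → a * x + b + a * q * y ≡ a * (x + q * y) + b
  factor = solve-∀

affine-injective : ∀ {a d r x y} → 2 ≤ a → a * x + d ≡ x + r → a * y + d ≡ y + r → x ≡ y
affine-injective {suc a} {d} {r} {x} {y} (s≤s 1≤a) hx hy =
  *-cancelˡ-≡ x y a {{>-nonZero 1≤a}}
    (+-cancelʳ-≡ d (a * x) (a * y) (trans (isolate hx) (sym (isolate hy))))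
  where
  isolate : ∀ {z} → suc a * z + d ≡ z + r → a * z + d ≡ r
  isolate {z} h = +-cancelˡ-≡ z (a * z + d) r (trans (sym (+-assoc z (a * z) d)) h)

two : Tm n
two = succ (succ zer)

num : ℕ → Tm n
num zero    = zer
num (suc k) = succ (num k)

pow : Tm n → ℕ → Tm n
pow t zero    = succ zer
pow t (suc k) = times t (pow t k)

evalTm-pow : ∀ (e : Vec ℕ n) t k → evalTm e (pow t k) ≡ evalTm e t ^ k
evalTm-pow e t zero    = refl
evalTm-pow e t (suc k) = cong (evalTm e t *_) (evalTm-pow e t k)

dbl : ℕ → Tm n
dbl zero    = succ zer
dbl (suc k) = times two (dbl k)

evalTm-dbl : ∀ (e : Vec ℕ n) k → evalTm e (dbl k) ≡ 2 ^ k
evalTm-dbl e zero    = refl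
evalTm-dbl e (suc k) = cong (2 *_) (evalTm-dbl e k)

-- ⌜ times two t ⌝ = ⟪ 4 , ⟪ 164 , ⌜ t ⌝ ⟫ ⟫ = slope * ⌜ t ⌝ + offset. Opaque so that the conversion
-- checker never unfolds slope * x into 2 ^ 170 additions.
opaque
  slope offset : ℕ
  slope  = 2 ^ 170
  offset = 32 * 2 ^ 164 + 16

  slopeᵀ offsetᵀ : Tm n
  slopeᵀ  = dbl 170
  offsetᵀ = plus (times (num 32) (dbl 164)) (num 16)

  evalTm-slopeᵀ : ∀ (e : Vec ℕ n) → evalTm e slopeᵀ ≡ slope
  evalTm-slopeᵀ e = evalTm-dbl e 170

  evalTm-offsetᵀ : ∀ (e : Vec ℕ n) → evalTm e offsetᵀ ≡ offset
  evalTm-offsetᵀ e = refl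

  slope≡ : slope ≡ 2 ^ 170
  slope≡ = refl

  2≤slope : 2 ≤ slope
  2≤slope = s≤s (s≤s z≤n)

  codeTm-dbl-suc : ∀ k → codeTm {n} (dbl (suc k)) ≡ slope * codeTm {n} (dbl k) + offset
  codeTm-dbl-suc k = expand (2 ^ 164) (codeTm (dbl k))
    where
    expand : ∀ a c → 16 * (2 * (a * (2 * c + 1)) + 1) ≡ 64 * a * c + (32 * a + 16)
    expand = solve-∀

slope^≡ : ∀ k → slope ^ k ≡ (2 ^ k) ^ 170
slope^≡ k = begin
  slope ^ k        ≡⟨ cong (_^ k) slope≡ ⟩
  (2 ^ 170) ^ k    ≡⟨ ^-*-assoc 2 170 k ⟩
  2 ^ (170 * k)    ≡⟨ cong (2 ^_) (*-comm 170 k) ⟩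
  2 ^ (k * 170)    ≡⟨ ^-*-assoc 2 k 170 ⟨
  (2 ^ k) ^ 170    ∎
  where open ≡-Reasoning

IsDblCode : ℕ → ℕ → Set
IsDblCode p c = slope * c + (offset + p ^ 170 * 20) ≡ c + p ^ 170 * (slope * 20 + offset)

dbl-IsDblCode : ∀ k → IsDblCode (2 ^ k) (codeTm {n} (dbl k))
dbl-IsDblCode {n} k = begin
  slope * c + (offset + (2 ^ k) ^ 170 * 20)   ≡⟨ +-assoc (slope * c) offset _ ⟨
  slope * c + offset + (2 ^ k) ^ 170 * 20     ≡⟨ cong₂ (λ x q → x + q * 20) (codeTm-dbl-suc k) (slope^≡ k) ⟨
  codeTm {n} (dbl (suc k)) + slope ^ k * 20   ≡⟨ affine-differences (λ k → codeTm {n} (dbl k)) slope offset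
                                                                    codeTm-dbl-suc k ⟩
  c + slope ^ k * codeTm {n} (dbl 1)          ≡⟨ cong₂ (λ q d → c + q * d) (slope^≡ k) (codeTm-dbl-suc {n} 0) ⟩
  c + (2 ^ k) ^ 170 * (slope * 20 + offset)   ∎
  where
  open ≡-Reasoning
  c = codeTm {n} (dbl k)

IsDblCode? : ∀ p c → Dec (IsDblCode p c)
IsDblCode? p c = _ ≟ _

IsDblCode-unique : ∀ {p c c′} → IsDblCode p c → IsDblCode p c′ → c ≡ c′
IsDblCode-unique = affine-injective 2≤slope

pairs : List ℕ → ℕ → ℕ
pairs []       y = y
pairs (k ∷ ks) y = ⟪ k , pairs ks y ⟫

pairᵀ : Tm n → Tm n → Tm n
pairᵀ a t = times a (plus (times two t) (succ zer))

pairsᵀ : List ℕ → Tm n → Tm n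
pairsᵀ []       t = t
pairsᵀ (k ∷ ks) t = pairᵀ (dbl k) (pairsᵀ ks t)

evalTm-pairsᵀ : ∀ (e : Vec ℕ n) ks t → evalTm e (pairsᵀ ks t) ≡ pairs ks (evalTm e t)
evalTm-pairsᵀ e []       t = refl
evalTm-pairsᵀ e (k ∷ ks) t =
  trans (cong (_* (2 * evalTm e (pairsᵀ ks t) + 1)) (evalTm-dbl e k))
        (cong ⟪ k ,_⟫ (evalTm-pairsᵀ e ks t))

diag : Fm (2 + n) → Tm (2 + n) → Fm n
diag A t = all (all (neg (and A (eq (var zero) t))))

-- Code p c is ⌜ diag A t ⌝ for p = 2 ^ ⌜ A ⌝ and c = ⌜ t ⌝ (tags of ∀, ∀, ¬, ∧, the factor
-- 2 ^ ⌜ A ⌝, tags of = and var zero). Opaque, and the proofs below spell out intermediate terms: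
-- otherwise the conversion checker unfolds the arithmetic of ⟪_,_⟫ and takes minutes.
opaque
  Codeᵀ : Tm n → Tm n → Tm n
  Codeᵀ p c = pairsᵀ (4 ∷ 4 ∷ 2 ∷ 3 ∷ []) (pairᵀ p (pairsᵀ (0 ∷ 1 ∷ []) c))

  Code : ℕ → ℕ → ℕ
  Code p c = pairs (4 ∷ 4 ∷ 2 ∷ 3 ∷ []) (p * (2 * pairs (0 ∷ 1 ∷ []) c + 1))

  codeFm-diag : ∀ (A : Fm (2 + n)) t → codeFm (diag A t) ≡ Code (2 ^ codeFm A) (codeTm t)
  codeFm-diag A t =
    cong ⟪ 4 ,_⟫ {codeFm (all (neg (and A (eq (var zero) t))))} (
    cong ⟪ 4 ,_⟫ {codeFm (neg (and A (eq (var zero) t)))} (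
    cong ⟪ 2 ,_⟫ {codeFm (and A (eq (var zero) t))} (
    cong ⟪ 3 ,_⟫ {⟪ codeFm A , codeFm (eq (var zero) t) ⟫} inner)))
    where
    inner : ⟪ codeFm A , codeFm (eq (var zero) t) ⟫ ≡
            2 ^ codeFm A * (2 * pairs (0 ∷ 1 ∷ []) (codeTm t) + 1)
    inner = refl

  evalTm-Codeᵀ : ∀ (e : Vec ℕ n) p c → evalTm e (Codeᵀ p c) ≡ Code (evalTm e p) (evalTm e c)
  evalTm-Codeᵀ e p c =
    trans (evalTm-pairsᵀ e (4 ∷ 4 ∷ 2 ∷ 3 ∷ []) (pairᵀ p (pairsᵀ (0 ∷ 1 ∷ []) c)))
          (cong (pairs (4 ∷ 4 ∷ 2 ∷ 3 ∷ []))
                {evalTm e (pairᵀ p (pairsᵀ (0 ∷ 1 ∷ []) c))}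
                {evalTm e p * (2 * pairs (0 ∷ 1 ∷ []) (evalTm e c) + 1)}
                (cong (λ z → evalTm e p * (2 * z + 1)) (evalTm-pairsᵀ e (0 ∷ 1 ∷ []) c)))

dblCodeˡ dblCodeʳ : Tm n → Tm n → Tm n
dblCodeˡ p c = plus (times slopeᵀ c) (plus offsetᵀ (times (pow p 170) (num 20)))
dblCodeʳ p c = plus c (times (pow p 170) (plus (times slopeᵀ (num 20)) offsetᵀ))

evalTm-dblCodeˡ : ∀ (e : Vec ℕ n) p c →
                  evalTm e (dblCodeˡ p c) ≡ slope * evalTm e c + (offset + evalTm e p ^ 170 * 20)
evalTm-dblCodeˡ e p c =
  cong₂ _+_ (cong (_* evalTm e c) (evalTm-slopeᵀ e))
            (cong₂ _+_ (evalTm-offsetᵀ e) (cong (_* 20) (evalTm-pow e p 170)))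

evalTm-dblCodeʳ : ∀ (e : Vec ℕ n) p c →
                  evalTm e (dblCodeʳ p c) ≡ evalTm e c + evalTm e p ^ 170 * (slope * 20 + offset)
evalTm-dblCodeʳ e p c =
  cong (evalTm e c +_)
       (cong₂ _*_ (evalTm-pow e p 170) (cong₂ _+_ (cong (_* 20) (evalTm-slopeᵀ e)) (evalTm-offsetᵀ e)))

∃ᶠ : Fm (suc n) → Fm n
∃ᶠ φ = neg (all (neg φ))

-- Θ(x, p) says ∃c. IsDblCode p c ∧ x = Code p c. Opaque: its code has 2 ^ ⌜ pow p 170 ⌝ as a
-- factor, so the type checker must never start computing it.
opaque
  Θ₀ : Fm 3
  Θ₀ = and (eq (dblCodeˡ (var (suc zero)) (var zero)) (dblCodeʳ (var (suc zero)) (var zero)))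
         (eq (var (suc (suc zero))) (Codeᵀ (var (suc zero)) (var zero)))

  Θ : Fm 2
  Θ = ∃ᶠ Θ₀

  Θ₀-true : ∀ {p x} c → IsDblCode p c → x ≡ Code p c → Tr X (c ∷ p ∷ x ∷ []) Θ₀
  Θ₀-true {p = p} {x} c d h = andT
    (eqT (trans (evalTm-dblCodeˡ (c ∷ p ∷ x ∷ []) (var (suc zero)) (var zero))
       (trans d (sym (evalTm-dblCodeʳ (c ∷ p ∷ x ∷ []) (var (suc zero)) (var zero))))))
    (eqT (trans h (sym (evalTm-Codeᵀ (c ∷ p ∷ x ∷ []) (var (suc zero)) (var zero)))))

  Θ₀-false : ∀ {p x} c → (IsDblCode p c → x ≢ Code p c) → Fa X (c ∷ p ∷ x ∷ []) Θ₀
  Θ₀-false {p = p} {x} c not-code with IsDblCode? p c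
  ... | no ¬d = andF₁ (eqF λ h → ¬d
        (trans (sym (evalTm-dblCodeˡ (c ∷ p ∷ x ∷ []) (var (suc zero)) (var zero)))
               (trans h (evalTm-dblCodeʳ (c ∷ p ∷ x ∷ []) (var (suc zero)) (var zero)))))
  ... | yes d = andF₂ (eqF λ h →
        not-code d (trans h (evalTm-Codeᵀ (c ∷ p ∷ x ∷ []) (var (suc zero)) (var zero))))

  Θ₀-exclusive : Tr X e Θ₀ → Fa X e Θ₀ → ⊥
  Θ₀-exclusive (andT (eqT h) _) (andF₁ (eqF ¬h)) = ¬h h
  Θ₀-exclusive (andT _ (eqT h)) (andF₂ (eqF ¬h)) = ¬h h

  Θ-true : ∀ {p x} c → IsDblCode p c → x ≡ Code p c → Tr X (p ∷ x ∷ []) Θ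
  Θ-true c d h = negT (allF c (negF (Θ₀-true c d h)))

  Θ-false : ∀ {p x} → (∀ c → IsDblCode p c → x ≢ Code p c) → Fa X (p ∷ x ∷ []) Θ
  Θ-false not-code = negF (allT λ c → negT (Θ₀-false c (not-code c)))

  Θ-not-false : ∀ {p x} c → IsDblCode p c → x ≡ Code p c → ¬ Fa X (p ∷ x ∷ []) Θ
  Θ-not-false c d h (negF (allT t)) with t c
  ... | negT f = Θ₀-exclusive (Θ₀-true c d h) f

glut : Tm n → Fm n
glut t = and (neg (tru t)) (tru t)

Aρ : Fm 2
Aρ = and Θ (glut (var (suc zero)))

-- Θ(x, 2 ^ ⌜ Aρ ⌝) holds exactly for x = ⌜ ρ ⌝, so ρ is never false, and true in X exactly when
-- ρ or ¬ρ is in X.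
ρ : Sentence
ρ = diag Aρ (dbl (codeFm Aρ))

ρ-code : ⌜ ρ ⌝ ≡ Code (2 ^ codeFm Aρ) (codeTm {2} (dbl (codeFm Aρ)))
ρ-code = codeFm-diag Aρ (dbl (codeFm Aρ))

Θ-not-false-at-ρ : ¬ Fa X (2 ^ codeFm Aρ ∷ ⌜ ρ ⌝ ∷ []) Θ
Θ-not-false-at-ρ = Θ-not-false {p = 2 ^ codeFm Aρ} _ (dbl-IsDblCode (codeFm Aρ)) ρ-code

Θ-false-off-ρ : ∀ {x} → x ≢ ⌜ ρ ⌝ → Fa X (2 ^ codeFm Aρ ∷ x ∷ []) Θ
Θ-false-off-ρ x≢ρ = Θ-false {p = 2 ^ codeFm Aρ} λ c d h →
  x≢ρ (trans h (trans (cong (Code _) (IsDblCode-unique {2 ^ codeFm Aρ} d (dbl-IsDblCode (codeFm Aρ))))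
                      (sym ρ-code)))

ρ-true : X ⌜ ρ ⌝ → TrueIn X ρ
ρ-true {X} ρ∈X = allT λ x → allT λ p → negT (instance-false x p (p ≟ 2 ^ codeFm Aρ) (x ≟ ⌜ ρ ⌝))
  where
  instance-false : ∀ x p → Dec (p ≡ 2 ^ codeFm Aρ) → Dec (x ≡ ⌜ ρ ⌝) →
                   Fa X (p ∷ x ∷ []) (and Aρ (eq (var zero) (dbl (codeFm Aρ))))
  instance-false x p (no p≢) _           = andF₂ (eqF λ h → p≢ (trans h (evalTm-dbl _ (codeFm Aρ))))
  instance-false x _ (yes refl) (no x≢ρ) = andF₁ (andF₁ (Θ-false-off-ρ x≢ρ))
  instance-false _ _ (yes refl) (yes refl) = andF₁ (andF₂ (andF₁ (negF (truT ρ∈X))))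

allT⁻ : Tr X e (all φ) → ∀ m → Tr X (m ∷ e) φ
allT⁻ (allT t) = t

ρ-true⇒decided : TrueIn X ρ → X ⌜ ρ ⌝ ⊎ X ⌜ neg ρ ⌝
ρ-true⇒decided {X} t = decided (allT⁻ (allT⁻ t ⌜ ρ ⌝) (2 ^ codeFm Aρ))
  where
  decided : Tr X (2 ^ codeFm Aρ ∷ ⌜ ρ ⌝ ∷ []) (neg (and Aρ (eq (var zero) (dbl (codeFm Aρ))))) →
            X ⌜ ρ ⌝ ⊎ X ⌜ neg ρ ⌝
  decided (negT (andF₂ (eqF p≢)))                           = ⊥-elim (p≢ (sym (evalTm-dbl _ (codeFm Aρ))))
  decided (negT (andF₁ (andF₁ Θ-fails)))                    = ⊥-elim (Θ-not-false-at-ρ Θ-fails)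
  decided (negT (andF₁ (andF₂ (andF₁ (negF (truT ρ∈X))))))  = inj₁ ρ∈X
  decided (negT (andF₁ (andF₂ (andF₂ (truFnc ¬code)))))     = ⊥-elim (¬code (ρ , refl))
  decided (negT (andF₁ (andF₂ (andF₂ (truFneg χ h ¬χ∈X))))) =
    inj₂ (subst (λ χ → X ⌜ neg χ ⌝) (codeFm-injective χ ρ h) ¬χ∈X)

ρ-never-false : (∀ {n} {e : Vec ℕ n} {φ} → Tr X e φ → Fa X e φ → ⊥) → ¬ FalseIn X ρ
ρ-never-false exclusive (allF _ (allF _ (negF (andT (andT _ (andT (negT f) t)) _)))) = exclusive t f

ρ-not-false : ∀ v → ¬ FalseAt v ρ
ρ-not-false v = ρ-never-false (fixedPoint-exclusive v)

ρ-not-true-in-leastFP : ¬ TrueAt leastFP ρ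
ρ-not-true-in-leastFP = needs-own-value⇒not-true-in-leastFP ρ-true⇒decided (ρ-not-false leastFP)

_⊕ρ : FixedPoint → FixedPoint
v ⊕ρ = lfp {B = S v ∪ ｛ ⌜ ρ ⌝ ｝} codes sound consistent′
  where
  codes : S v ∪ ｛ ⌜ ρ ⌝ ｝ ⊆ IsSentenceCode
  codes (inj₁ s)    = sentCodes v _ s
  codes (inj₂ refl) = ρ , refl

  sound : ∀ φ → (S v ∪ ｛ ⌜ ρ ⌝ ｝) ⌜ φ ⌝ → TrueIn (S v ∪ ｛ ⌜ ρ ⌝ ｝) φ
  sound φ (inj₁ s) = Tr-mono inj₁ (closed→ v φ s)
  sound φ (inj₂ h) = subst (TrueIn _) (codeFm-injective ρ φ h) (ρ-true (inj₂ refl))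

  consistent′ : Consistent (S v ∪ ｛ ⌜ ρ ⌝ ｝)
  consistent′ φ (inj₁ s , inj₁ s′) = consistent v φ (s , s′)
  consistent′ φ (_ , inj₂ h) = ρ≢neg (codeFm-injective ρ (neg φ) h)
    where
    ρ≢neg : ρ ≢ neg φ
    ρ≢neg ()
  consistent′ φ (inj₂ h , inj₁ s′) = ρ-not-false v (Tr-neg⁻ (closed→ v (neg ρ) ¬ρ∈v))
    where
    ¬ρ∈v : S v ⌜ neg ρ ⌝
    ¬ρ∈v = subst (λ χ → S v ⌜ neg χ ⌝) (sym (codeFm-injective ρ φ h)) s′

⊕ρ-extends : ∀ v → S v ⊆ S (v ⊕ρ)
⊕ρ-extends v s = base (inj₁ s)

ρ-true-in-⊕ρ : ∀ v → TrueAt (v ⊕ρ) ρ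
ρ-true-in-⊕ρ v = closed→ (v ⊕ρ) ρ (base (inj₂ refl))

⊕ρ-mono : S v ⊆ S v′ → S (v ⊕ρ) ⊆ S (v′ ⊕ρ)
⊕ρ-mono {v} {v′} inc = LFP-least [ ⊕ρ-extends v′ ∘ inc , (λ h → base (inj₂ h)) ] (closed← (v′ ⊕ρ))

leastFP⊕ρ-intrinsic : IntrinsicFP (leastFP ⊕ρ)
leastFP⊕ρ-intrinsic =
  compatible⇒intrinsic {leastFP ⊕ρ} λ v → v ⊕ρ , ⊕ρ-mono {leastFP} {v} (leastFP-⊆ v) , ⊕ρ-extends v

ρ-intrinsic : Intrinsic ρ
ρ-intrinsic = leastFP ⊕ρ , leastFP⊕ρ-intrinsic , inj₁ (ρ-true-in-⊕ρ leastFP)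

¬ρ-intrinsic : Intrinsic (neg ρ)
¬ρ-intrinsic = leastFP ⊕ρ , leastFP⊕ρ-intrinsic , inj₂ (negF (ρ-true-in-⊕ρ leastFP))

⊩-onlyVar : ∀ {x ⋆ ⋆′ w} φ → OnlyVar x φ → ⋆ x ≡ ⋆′ x → w ⊩[ ⋆ ] φ → w ⊩[ ⋆′ ] φ
⊩-onlyVar {w = w} (T y) refl h (lift t) = lift (subst (TrueAt w) h t)
⊩-onlyVar {w = w} (F y) refl h (lift f) = lift (subst (FalseAt w) h f)
⊩-onlyVar (¬ₘ φ)   only h ¬φ       = ¬φ ∘ ⊩-onlyVar φ only (sym h)
⊩-onlyVar (φ ∧ₘ ψ) (only₁ , only₂) h (φ-holds , ψ-holds) =
  ⊩-onlyVar φ only₁ h φ-holds , ⊩-onlyVar ψ only₂ h ψ-holds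
⊩-onlyVar (□ φ)    only h □φ v     = ⊩-onlyVar φ only h (□φ v)

record SameValue (σ : Sentence) (v : FixedPoint) (σ′ : Sentence) (v′ : FixedPoint) : Set where
  constructor same
  field
    true⇔  : TrueAt v σ ⇔ TrueAt v′ σ′
    false⇔ : FalseAt v σ ⇔ FalseAt v′ σ′

SameValue-sym : SameValue σ v σ′ v′ → SameValue σ′ v′ σ v
SameValue-sym (same t f) = same (⇔-sym t) (⇔-sym f)

record Matches (σ σ′ : Sentence) : Set₁ where
  field
    forth : ∀ v  → ¬ ¬ (Σ[ v′ ∈ FixedPoint ] SameValue σ v σ′ v′)
    back  : ∀ v′ → ¬ ¬ (Σ[ v ∈ FixedPoint ] SameValue σ v σ′ v′)

open Matches

Matches-sym : Matches σ σ′ → Matches σ′ σ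
Matches-sym m = record
  { forth = λ v  → ¬¬-map (map₂ SameValue-sym) (back m v)
  ; back  = λ v′ → ¬¬-map (map₂ SameValue-sym) (forth m v′)
  }

Matches-refl : Matches σ σ
Matches-refl = record
  { forth = λ v → pure (v , same (⇔-id _) (⇔-id _))
  ; back  = λ v → pure (v , same (⇔-id _) (⇔-id _))
  }

-- Forcing is stable under ¬¬ except at atoms, and an atom holds everywhere once it holds at
-- leastFP.
¬¬-shift : ∀ σ φ → (∀ u → ¬ ¬ (u ⊩[ const σ ] φ)) → ¬ ¬ (∀ u → u ⊩[ const σ ] φ)
¬¬-shift σ (T _)    h = ¬¬-map (λ (lift t) u → lift (TrueAt-mono {leastFP} {u} (leastFP-⊆ u) t)) (h leastFP)
¬¬-shift σ (F _)    h = ¬¬-map (λ (lift f) u → lift (FalseAt-mono {leastFP} {u} (leastFP-⊆ u) f)) (h leastFP)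
¬¬-shift σ (¬ₘ φ)   h = pure (λ u → negated-stable (h u))
¬¬-shift σ (φ ∧ₘ ψ) h = do
  φ-holds ← ¬¬-shift σ φ (λ u → ¬¬-map proj₁ (h u))
  ψ-holds ← ¬¬-shift σ ψ (λ u → ¬¬-map proj₂ (h u))
  pure (λ u → φ-holds u , ψ-holds u)
¬¬-shift σ (□ φ)    h = ¬¬-map const (h leastFP)

⊩-transfer : Matches σ σ′ → SameValue σ v σ′ v′ →
             ∀ φ → v ⊩[ const σ ] φ → ¬ ¬ (v′ ⊩[ const σ′ ] φ)
⊩-transfer m (same t _) (T _) (lift σ-true)  = pure (lift (Equivalence.to t σ-true))
⊩-transfer m (same _ f) (F _) (lift σ-false) = pure (lift (Equivalence.to f σ-false))
⊩-transfer m z (¬ₘ φ) ¬φ = pure λ φ′ → ⊩-transfer (Matches-sym m) (SameValue-sym z) φ φ′ ¬φ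
⊩-transfer m z (φ ∧ₘ ψ) (φ-holds , ψ-holds) = do
  φ′ ← ⊩-transfer m z φ φ-holds
  ψ′ ← ⊩-transfer m z ψ ψ-holds
  pure (φ′ , ψ′)
⊩-transfer {σ′ = σ′} m z (□ φ) □φ = ¬¬-shift σ′ φ λ u′ → do
  (u , z′) ← back m u′
  ⊩-transfer m z′ φ (□φ u)

matches-by : (P P′ : FixedPoint → Set) → (∀ {v v′} → P v ⇔ P′ v′ → SameValue σ v σ′ v′) →
             Σ FixedPoint P → Σ FixedPoint P′ → Σ FixedPoint (¬_ ∘ P) → Σ FixedPoint (¬_ ∘ P′) →
             Matches σ σ′
matches-by {σ} {σ′} P P′ agree (w₁ , p₁) (w₁′ , p₁′) (w₀ , ¬p₀) (w₀′ , ¬p₀′) = record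
  { forth = λ v  → ¬¬-map (forth-by v) ¬¬-excluded-middle
  ; back  = λ v′ → ¬¬-map (back-by v′) ¬¬-excluded-middle
  }
  where
  forth-by : ∀ v → Dec (P v) → Σ[ v′ ∈ FixedPoint ] SameValue σ v σ′ v′
  forth-by v (yes p) = w₁′ , agree (mk⇔ (const p₁′) (const p))
  forth-by v (no ¬p) = w₀′ , agree (mk⇔ (⊥-elim ∘ ¬p) (⊥-elim ∘ ¬p₀′))
  back-by : ∀ v′ → Dec (P′ v′) → Σ[ v ∈ FixedPoint ] SameValue σ v σ′ v′
  back-by v′ (yes p′) = w₁ , agree (mk⇔ (const p′) (const p₁))
  back-by v′ (no ¬p′) = w₀ , agree (mk⇔ (⊥-elim ∘ ¬p₀) (⊥-elim ∘ ¬p′))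

inevitable-matches-intrinsic : Inevitable σ → ¬ ¬ (Σ[ σ′ ∈ Sentence ] Intrinsic σ′ × Matches σ σ′)
inevitable-matches-intrinsic {σ} inevitable = ¬¬-map (pick inevitable) ¬¬-excluded-middle
  where
  pick : Inevitable σ → Dec (TrueAt leastFP σ ⊎ FalseAt leastFP σ) →
         Σ[ σ′ ∈ Sentence ] Intrinsic σ′ × Matches σ σ′
  pick _ (yes valued) = σ , (leastFP , leastFP-intrinsic , valued) , Matches-refl
  pick (inj₁ ((w , σ-true) , never-false)) (no unvalued) =
    ρ , ρ-intrinsic ,
    matches-by (λ v → TrueAt v σ) (λ v → TrueAt v ρ)
      (λ {v} {v′} t → same t (mk⇔ (λ f → ⊥-elim (never-false (v , f))) (⊥-elim ∘ ρ-not-false v′)))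
      (w , σ-true) (leastFP ⊕ρ , ρ-true-in-⊕ρ leastFP)
      (leastFP , unvalued ∘ inj₁) (leastFP , ρ-not-true-in-leastFP)
  pick (inj₂ ((w , σ-false) , never-true)) (no unvalued) =
    neg ρ , ¬ρ-intrinsic ,
    matches-by (λ v → FalseAt v σ) (λ v → TrueAt v ρ)
      (λ {v} {v′} f → same (mk⇔ (λ t → ⊥-elim (never-true (v , t))) (⊥-elim ∘ ρ-not-false v′ ∘ Tr-neg⁻))
                           (mk⇔ (negF ∘ Equivalence.to f) (Equivalence.from f ∘ Fa-neg⁻)))
      (w , σ-false) (leastFP ⊕ρ , ρ-true-in-⊕ρ leastFP)
      (leastFP , unvalued ∘ inj₂) (leastFP , ρ-not-true-in-leastFP)

intrinsic⇒inevitable : Intrinsic σ → Inevitable σ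
intrinsic⇒inevitable {σ} (w , w-intrinsic , inj₁ σ-true) =
  inj₁ ((w , σ-true) , λ (v , σ-false) → w-intrinsic v (σ , inj₁ σ-true , inj₂ (negT σ-false)))
intrinsic⇒inevitable {σ} (w , w-intrinsic , inj₂ σ-false) =
  inj₂ ((w , σ-false) , λ (v , σ-true) → w-intrinsic v (σ , inj₂ σ-true , inj₁ (negT σ-false)))

-- No atom is valid for all intrinsic realizations, as ρ has no value at leastFP.
intrinsic-valid⇒inevitable-valid : Inevitable σ → ∀ φ →
  (∀ σ′ → Intrinsic σ′ → FIX⊩[ const σ′ ] φ) → FIX⊩[ const σ ] φ
intrinsic-valid⇒inevitable-valid inevitable (T _) valid w =
  ⊥-elim (ρ-not-true-in-leastFP (lower (valid ρ ρ-intrinsic leastFP)))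
intrinsic-valid⇒inevitable-valid inevitable (F _) valid w =
  ⊥-elim (ρ-not-false leastFP (lower (valid ρ ρ-intrinsic leastFP)))
intrinsic-valid⇒inevitable-valid inevitable (¬ₘ φ) valid w φ-holds =
  inevitable-matches-intrinsic inevitable λ (σ′ , intrinsic , m) →
  forth m w λ (w′ , z) →
  ⊩-transfer m z φ φ-holds (valid σ′ intrinsic w′)
intrinsic-valid⇒inevitable-valid inevitable (φ ∧ₘ ψ) valid w =
  intrinsic-valid⇒inevitable-valid inevitable φ (λ σ′ i u → proj₁ (valid σ′ i u)) w ,
  intrinsic-valid⇒inevitable-valid inevitable ψ (λ σ′ i u → proj₂ (valid σ′ i u)) w
intrinsic-valid⇒inevitable-valid inevitable (□ φ) valid w =
  intrinsic-valid⇒inevitable-valid inevitable φ (λ σ′ i → valid σ′ i leastFP)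

mainTheorem12 : Indiscernible Intrinsic Inevitable
mainTheorem12 x φ only-x =
  (λ valid ⋆ inevitable w → ⊩-onlyVar φ only-x refl
     (intrinsic-valid⇒inevitable-valid inevitable φ (λ σ′ intrinsic → valid (const σ′) intrinsic) w)) ,
  (λ valid ⋆ → valid ⋆ ∘ intrinsic⇒inevitable)
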